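{- Let $k$ be a positive integer and let $P_k$ denote the product of the first $k$ primes. If $(m,n)$ is an interlocking pair with $mn = P_k$, then $k \le 8$.
   Context: Two positive integers $m$ and $n$ interlock (and $(m,n)$ is called an interlocking pair) if strictly between any two divisors of $n$ that are both larger than $1$ there lies a divisor of $m$, and strictly between any two divisors of $m$ that are both larger than $1$ there lies a divisor of $n$. -}

module Defs where

open import Data.Nat using (ℕ; suc; _<_; _*_)
open import Data.Nat.Divisibility using (_∣_)
open import Data.Nat.Primality using (Prime; prime?)
open import Data.List using (List; filter; upTo; length)
open import Data.Nat.ListAction using (product)
open import Data.Product using (∃-syntax; _×_)
open import Relation.Binary.PropositionalEquality using (_≡_)

primesUpTo : ℕ → List ℕ
primesUpTo n = filter prime? (upTo (suc n))

DivisorsSeparatedBy : ℕ → ℕ → Set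
DivisorsSeparatedBy n m =
  ∀ a b → 1 < a → 1 < b → a ∣ n → b ∣ n → a < b →
  ∃[ d ] (d ∣ m × a < d × d < b)

Interlock : ℕ → ℕ → Set
Interlock m n = DivisorsSeparatedBy n m × DivisorsSeparatedBy m n

-- P k N : N is the product of the first k primes (k ≥ 1), i.e. N is the
-- product of all primes ≤ p, where p is prime and is the k-th prime.
IsPrimorial : ℕ → ℕ → Set
IsPrimorial k N =
  ∃[ p ] (Prime p × length (primesUpTo p) ≡ k × N ≡ product (primesUpTo p))

-- For k ≥ 9 the primes 2, 3, 5, …, 23 divide m n exactly once, so each of
-- them lies on exactly one side; by symmetry say 2 ∣ m. Two divisors of one side
-- that are close together force a divisor of the other side into the short
-- gap between them, and that divisor shares a small prime with the first
-- side; following these gaps decides the side of 3, 5, …, 23 one by one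
-- (3 ∣ n, 5 ∣ m, 7 ∣ n, 11 ∣ n, 13 ∣ m, 17 ∣ n, 19 ∣ m, 23 ∣ m) until the
-- divisors 23 and 26 of m leave only 24 or 25 for n, both impossible.
module Submission where

open import Defs
open import Data.Nat using (ℕ; zero; suc; _≤_; _<_; _*_; _+_; _<?_; _≤?_; z≤n; s≤s; s≤s⁻¹; NonTrivial; nonTrivial⇒n>1)
open import Data.Nat.Properties
open import Algebra.Properties.CommutativeSemigroup *-commutativeSemigroup using (xy∙z≈xz∙y)
open import Data.Nat.Divisibility
open import Data.Nat.LCM using (lcm-least)
open import Data.Nat.Primality
open import Data.Nat.ListAction using (product)
open import Data.Nat.ListAction.Properties using (product-++)
open import Data.List using ([]; _∷_; _++_; filter; upTo; length)
open import Data.List.Properties using (upTo-∷ʳ; filter-++; filter-accept; filter-reject)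
open import Data.Product using (∃-syntax; _×_; _,_; proj₁; proj₂; swap)
open import Data.Sum using (_⊎_; inj₁; inj₂)
open import Data.Empty using (⊥; ⊥-elim)
open import Function using (_∘_)
open import Relation.Nullary using (¬_; yes; no; contradiction)
open import Relation.Nullary.Decidable using (True; toWitness)
open import Relation.Binary.PropositionalEquality using (_≡_; refl; sym; trans; cong; subst; module ≡-Reasoning)

private
  variable
    a b m n q : ℕ

primorial : ℕ → ℕ
primorial n = product (primesUpTo n)

primorial-suc : ∀ n → primorial (suc n) ≡ primorial n * product (filter prime? (suc n ∷ []))
primorial-suc n = begin
  product (filter prime? (upTo (suc (suc n))))          ≡⟨ cong (λ ns → product (filter prime? ns)) (upTo-∷ʳ (suc n)) ⟨
  product (filter prime? (upTo (suc n) ++ suc n ∷ []))  ≡⟨ cong product (filter-++ prime? (upTo (suc n)) _) ⟩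
  product (primesUpTo n ++ filter prime? (suc n ∷ []))  ≡⟨ product-++ (primesUpTo n) _ ⟩
  primorial n * product (filter prime? (suc n ∷ []))    ∎
  where open ≡-Reasoning

primorial-suc-prime : Prime (suc n) → primorial (suc n) ≡ primorial n * suc n
primorial-suc-prime {n} p = begin
  primorial (suc n)                                   ≡⟨ primorial-suc n ⟩
  primorial n * product (filter prime? (suc n ∷ []))  ≡⟨ cong (λ ps → primorial n * product ps) (filter-accept prime? p) ⟩
  primorial n * (suc n * 1)                           ≡⟨ cong (primorial n *_) (*-identityʳ (suc n)) ⟩
  primorial n * suc n                                 ∎
  where open ≡-Reasoning

primorial-suc-¬prime : ¬ Prime (suc n) → primorial (suc n) ≡ primorial n
primorial-suc-¬prime {n} ¬p = begin
  primorial (suc n)                                   ≡⟨ primorial-suc n ⟩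
  primorial n * product (filter prime? (suc n ∷ []))  ≡⟨ cong (λ ps → primorial n * product ps) (filter-reject prime? ¬p) ⟩
  primorial n * 1                                     ≡⟨ *-identityʳ (primorial n) ⟩
  primorial n                                         ∎
  where open ≡-Reasoning

prime∣primorial⇒≤ : ∀ n → Prime q → q ∣ primorial n → q ≤ n
prime∣primorial⇒≤ zero q-prime q∣1 = ⊥-elim (¬prime[1] (subst Prime (∣1⇒≡1 q∣1) q-prime))
prime∣primorial⇒≤ {q} (suc n) q-prime q∣P with prime? (suc n)
... | no ¬p = m≤n⇒m≤1+n (prime∣primorial⇒≤ n q-prime (subst (q ∣_) (primorial-suc-¬prime ¬p) q∣P))
... | yes p with euclidsLemma (primorial n) (suc n) q-prime (subst (q ∣_) (primorial-suc-prime p) q∣P)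
...   | inj₁ q∣P′ = m≤n⇒m≤1+n (prime∣primorial⇒≤ n q-prime q∣P′)
...   | inj₂ q∣1+n = ∣⇒≤ q∣1+n

prime≤⇒∣primorial : ∀ n → Prime q → q ≤ n → q ∣ primorial n
prime≤⇒∣primorial zero q-prime z≤n = contradiction q-prime ¬prime[0]
prime≤⇒∣primorial {q} (suc n) q-prime q≤1+n with prime? (suc n) | m≤n⇒m<n∨m≡n q≤1+n
... | no ¬p | inj₁ q≤n = subst (q ∣_) (sym (primorial-suc-¬prime ¬p))
                            (prime≤⇒∣primorial n q-prime (s≤s⁻¹ q≤n))
... | no ¬p | inj₂ refl = contradiction q-prime ¬p
... | yes p | inj₁ q≤n = subst (q ∣_) (sym (primorial-suc-prime p))
                            (∣m⇒∣m*n (suc n) (prime≤⇒∣primorial n q-prime (s≤s⁻¹ q≤n)))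
... | yes p | inj₂ refl = subst (q ∣_) (sym (primorial-suc-prime p)) (n∣m*n (primorial n))

prime²∣*⇒ : Prime q → ¬ q ∣ b → q * q ∣ a * b → q * q ∣ a
prime²∣*⇒ {q} {b} {a} q-prime q∤b q²∣ab with euclidsLemma a b q-prime (m*n∣⇒m∣ q q q²∣ab)
... | inj₂ q∣b = contradiction q∣b q∤b
... | inj₁ (divides c refl) = *-monoˡ-∣ q q∣c
  where
  instance _ = prime⇒nonZero q-prime
  q∣cb : q ∣ c * b
  q∣cb = *-cancelʳ-∣ q (subst (q * q ∣_) (xy∙z≈xz∙y c q b) q²∣ab)
  q∣c : q ∣ c
  q∣c with euclidsLemma c b q-prime q∣cb
  ... | inj₁ q∣c = q∣c
  ... | inj₂ q∣b = contradiction q∣b q∤b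

prime²∤primorial : ∀ n → Prime q → ¬ q * q ∣ primorial n
prime²∤primorial zero q-prime q²∣1 = ¬prime[1] (subst Prime (∣1⇒≡1 (m*n∣⇒m∣ _ _ q²∣1)) q-prime)
prime²∤primorial {q} (suc n) q-prime q²∣P with prime? (suc n)
... | no ¬p = prime²∤primorial n q-prime (subst (q * q ∣_) (primorial-suc-¬prime ¬p) q²∣P)
... | yes p = q²∤P*[1+n] (subst (q * q ∣_) (primorial-suc-prime p) q²∣P)
  where
  q²∤P*[1+n] : ¬ q * q ∣ primorial n * suc n
  q²∤P*[1+n] with q ∣? suc n
  ... | no q∤1+n = prime²∤primorial n q-prime ∘ prime²∣*⇒ q-prime q∤1+n
  ... | yes q∣1+n with prime⇒irreducible p q∣1+n
  ...   | inj₁ refl = contradiction q-prime ¬prime[1]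
  ...   | inj₂ refl = n≮n n ∘ prime∣primorial⇒≤ n q-prime ∘ *-cancelʳ-∣ q

PrimesUpToDivideOnce : ℕ → ℕ → Set
PrimesUpToDivideOnce x N = ∀ {q} → Prime q → q ≤ x → q ∣ N × ¬ q * q ∣ N

primorial-primesUpToDivideOnce : ∀ {x p} → x ≤ p → PrimesUpToDivideOnce x (primorial p)
primorial-primesUpToDivideOnce {p = p} x≤p q-prime q≤x =
  prime≤⇒∣primorial p q-prime (≤-trans q≤x x≤p) , prime²∤primorial p q-prime

module _ (separated : DivisorsSeparatedBy n m) where

  separating-divisor : ∀ k → .{{NonTrivial a}} → a ∣ n → k + suc a ∣ n →
                       ∃[ i ] (i < k × i + suc a ∣ m)
  separating-divisor {a} k a∣n b∣n
    with separated a (k + suc a) 1<a (<-trans 1<a a<b) a∣n b∣n a<b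
    where
    1<a = nonTrivial⇒n>1 a
    a<b = m≤n+m (suc a) k
  ... | d , d∣m , a<d , d<b with m≤n⇒∃[o]m+o≡n a<d
  ...   | i , 1+a+i≡d = i , +-cancelʳ-< (suc a) i k (subst (_< k + suc a) (sym i+1+a≡d) d<b)
                          , subst (_∣ m) (sym i+1+a≡d) d∣m
    where
    i+1+a≡d : i + suc a ≡ d
    i+1+a≡d = trans (+-comm i (suc a)) 1+a+i≡d

  ¬consecutive-divisors : .{{NonTrivial a}} → a ∣ n → ¬ suc a ∣ n
  ¬consecutive-divisors a∣n 1+a∣n with separating-divisor 0 a∣n 1+a∣n
  ... | _ , () , _

  middle-divisor : .{{NonTrivial a}} → a ∣ n → suc (suc a) ∣ n → suc a ∣ m
  middle-divisor a∣n 2+a∣n with separating-divisor 1 a∣n 2+a∣n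
  ... | zero , _ , 1+a∣m = 1+a∣m
  ... | suc _ , s≤s () , _

module _ (interlock : Interlock m n) (once : PrimesUpToDivideOnce 23 (m * n)) where

  private
    sepₙ : DivisorsSeparatedBy n m
    sepₙ = proj₁ interlock

    sepₘ : DivisorsSeparatedBy m n
    sepₘ = proj₂ interlock

    ∣m⊎∣n : ∀ q {q-prime : True (prime? q)} {q≤23 : True (q ≤? 23)} → q ∣ m ⊎ q ∣ n
    ∣m⊎∣n q {q-prime} {q≤23} =
      euclidsLemma m n (toWitness q-prime) (proj₁ (once (toWitness q-prime) (toWitness q≤23)))

    ¬∣m×∣n : ∀ q {q-prime : True (prime? q)} {q≤23 : True (q ≤? 23)} → q ∣ m → ¬ q ∣ n
    ¬∣m×∣n q {q-prime} {q≤23} q∣m q∣n =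
      proj₂ (once (toWitness q-prime) (toWitness q≤23)) (*-pres-∣ q∣m q∣n)

    ∣m-unless : ∀ q {q-prime : True (prime? q)} {q≤23 : True (q ≤? 23)} → ¬ q ∣ n → q ∣ m
    ∣m-unless q {q-prime} {q≤23} q∤n with ∣m⊎∣n q {q-prime} {q≤23}
    ... | inj₁ q∣m = q∣m
    ... | inj₂ q∣n = contradiction q∣n q∤n

    ∣n-unless : ∀ q {q-prime : True (prime? q)} {q≤23 : True (q ≤? 23)} → ¬ q ∣ m → q ∣ n
    ∣n-unless q {q-prime} {q≤23} q∤m with ∣m⊎∣n q {q-prime} {q≤23}
    ... | inj₁ q∣m = contradiction q∣m q∤m
    ... | inj₂ q∣n = q∣n

  ¬2∣m : ¬ 2 ∣ m
  ¬2∣m 2∣m = gap-23-26 (separating-divisor sepₘ 2 23∣m (lcm-least 2∣m 13∣m))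
    where
    3∣n : 3 ∣ n
    3∣n = ∣n-unless 3 (¬consecutive-divisors sepₘ 2∣m)

    5∣m : 5 ∣ m
    5∣m = ∣m-unless 5 λ 5∣n →
      proj₂ (once prime[2] (s≤s (s≤s z≤n))) (∣m⇒∣m*n n (middle-divisor sepₙ 3∣n 5∣n))

    7∣n : 7 ∣ n
    7∣n = ∣n-unless 7 λ 7∣m → ¬∣m×∣n 2 2∣m (∣-trans (divides 3 refl) (middle-divisor sepₘ 5∣m 7∣m))

    11∣n : 11 ∣ n
    11∣n = ∣n-unless 11 (¬consecutive-divisors sepₘ (lcm-least 2∣m 5∣m))

    13∣m : 13 ∣ m
    13∣m = ∣m-unless 13 λ 13∣n →
      ¬∣m×∣n 3 (∣-trans (divides 4 refl) (middle-divisor sepₙ 11∣n 13∣n)) 3∣n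

    17∣n : 17 ∣ n
    17∣n = ∣n-unless 17 λ 17∣m → gap-13-17 (separating-divisor sepₘ 3 13∣m 17∣m)
      where
      gap-13-17 : ∃[ i ] (i < 3 × i + 14 ∣ n) → ⊥
      gap-13-17 (0 , _ , 14∣n) = ¬∣m×∣n 2 2∣m (∣-trans (divides 7 refl) 14∣n)
      gap-13-17 (1 , _ , 15∣n) = ¬∣m×∣n 5 5∣m (∣-trans (divides 3 refl) 15∣n)
      gap-13-17 (2 , _ , 16∣n) = ¬∣m×∣n 2 2∣m (∣-trans (divides 8 refl) 16∣n)
      gap-13-17 (suc (suc (suc _)) , s≤s (s≤s (s≤s ())) , _)

    19∣m : 19 ∣ m
    19∣m = ∣m-unless 19 λ 19∣n →
      ¬∣m×∣n 3 (∣-trans (divides 6 refl) (middle-divisor sepₙ 17∣n 19∣n)) 3∣n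

    23∣m : 23 ∣ m
    23∣m = ∣m-unless 23 λ 23∣n →
      ¬∣m×∣n 11 (∣-trans (divides 2 refl) (middle-divisor sepₙ (lcm-least 3∣n 7∣n) 23∣n)) 11∣n

    gap-23-26 : ∃[ i ] (i < 2 × i + 24 ∣ n) → ⊥
    gap-23-26 (0 , _ , 24∣n) = ¬∣m×∣n 2 2∣m (∣-trans (divides 12 refl) 24∣n)
    gap-23-26 (1 , _ , 25∣n) = ¬∣m×∣n 5 5∣m (∣-trans (divides 5 refl) 25∣n)
    gap-23-26 (suc (suc _) , s≤s (s≤s ()) , _)

interlock⇒¬primesUpTo23DivideOnce : Interlock m n → ¬ PrimesUpToDivideOnce 23 (m * n)
interlock⇒¬primesUpTo23DivideOnce {m} {n} interlock once
  with euclidsLemma m n prime[2] (proj₁ (once prime[2] (s≤s (s≤s z≤n))))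
... | inj₁ 2∣m = ¬2∣m interlock once 2∣m
... | inj₂ 2∣n = ¬2∣m (swap interlock) (subst (PrimesUpToDivideOnce 23) (*-comm m n) once) 2∣n

length-primesUpTo-<23 : ∀ {p} → p < 23 → length (primesUpTo p) ≤ 8
length-primesUpTo-<23 = toWitness {a? = allUpTo? (λ p → length (primesUpTo p) ≤? 8) 23} _

mainTheorem5 : (k : ℕ) → 1 ≤ k → (m n : ℕ) →
               IsPrimorial k (m * n) → Interlock m n → k ≤ 8
mainTheorem5 k _ m n (p , _ , length≡k , mn≡P) interlock with p <? 23
... | yes p<23 = subst (_≤ 8) length≡k (length-primesUpTo-<23 p<23)
... | no p≮23  = ⊥-elim (interlock⇒¬primesUpTo23DivideOnce interlock
                   (subst (PrimesUpToDivideOnce 23) (sym mn≡P) (primorial-primesUpToDivideOnce (≮⇒≥ p≮23))))
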